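{- For IBCI-algebras $\langle\mathbb{A},\Rightarrow\!\!>,\Rightarrow,[\top,\top]\rangle$, with $X\ll Y$ iff $X\Rightarrow\!\!> Y=[\top,\top]$ and $X\precsim Y$ iff $X\Rightarrow Y=[\top,\top]$, the properties "$X\ll Y$ if and only if $X\Rightarrow Y=[\top,\top]$" and "$X\precsim Y$ if and only if $X\Rightarrow\!\!> Y=[\top,\top]$" do not hold in general (for all $X,Y$). However, in every IBCI-algebra, for all $X,Y\in\mathbb{A}$: (a) if $X\ll Y$ then $X\Rightarrow Y=[\top,\top]$; (b) if $X\Rightarrow\!\!> Y=[\top,\top]$ then $X\precsim Y$.
   Context: A BCI-algebra is a structure $\langle A,\rightarrow,\top\rangle$ such that for all $x,y,z\in A$: (C1) $(y\rightarrow z)\rightarrow((z\rightarrow x)\rightarrow(y\rightarrow x))=\top$; (C2) $x\rightarrow((x\rightarrow y)\rightarrow y)=\top$; (C3) $x\rightarrow x=\top$; (C4) $x\rightarrow y=\top$ and $y\rightarrow x=\top$ imply $x=y$; its induced order is $x\preceq y$ iff $x\rightarrow y=\top$. Given such an algebra with $\langle A,\preceq\rangle$ a meet-semilattice and $x\rightarrow(y\wedge z)=(x\rightarrow y)\wedge(x\rightarrow z)$ for all $x,y,z$, let $\mathbb{A}=\{[a,b]:a,b\in A,\ a\preceq b\}$, $\underline{[a,b]}=a$, $\overline{[a,b]}=b$. Define $X\Rightarrow\!\!> Y=[\overline{X}\rightarrow\underline{Y},\ \underline{X}\rightarrow\overline{Y}]$ and $X\Rightarrow Y=[(\underline{X}\rightarrow\underline{Y})\wedge(\overline{X}\rightarrow\overline{Y}),\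 \underline{X}\rightarrow\overline{Y}]$; $\langle\mathbb{A},\Rightarrow\!\!>,\Rightarrow,[\top,\top]\rangle$ is the IBCI-algebra obtained from $\langle A,\rightarrow,\top\rangle$. -}

module Defs where

open import Level using (Level; suc; _⊔_)
open import Data.Product using (_×_; _,_; proj₁; proj₂)
open import Relation.Binary.PropositionalEquality using (_≡_)

record MeetBCI (c : Level) : Set (suc c) where
  infixr 5 _⟶_
  infixr 6 _∧_
  field
    Carrier : Set c
    _⟶_     : Carrier → Carrier → Carrier
    ⊤       : Carrier
    C1 : ∀ x y z → (y ⟶ z) ⟶ ((z ⟶ x) ⟶ (y ⟶ x)) ≡ ⊤
    C2 : ∀ x y → x ⟶ ((x ⟶ y) ⟶ y) ≡ ⊤
    C3 : ∀ x → x ⟶ x ≡ ⊤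
    C4 : ∀ x y → x ⟶ y ≡ ⊤ → y ⟶ x ≡ ⊤ → x ≡ y

  _⪯_ : Carrier → Carrier → Set c
  x ⪯ y = x ⟶ y ≡ ⊤

  field
    _∧_       : Carrier → Carrier → Carrier
    ∧-lowerˡ  : ∀ x y → (x ∧ y) ⪯ x
    ∧-lowerʳ  : ∀ x y → (x ∧ y) ⪯ y
    ∧-greatest : ∀ x y z → z ⪯ x → z ⪯ y → z ⪯ (x ∧ y)
    ⟶-∧-distrib : ∀ x y z → x ⟶ (y ∧ z) ≡ (x ⟶ y) ∧ (x ⟶ z)

module IBCI {c : Level} (B : MeetBCI c) where
  open MeetBCI B

  -- Elements of 𝔸: intervals [a , b] with a ⪯ b.
  record Interval : Set c where
    constructor [_,_∣_]
    field
      lo : Carrier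
      hi : Carrier
      lo⪯hi : lo ⪯ hi
  open Interval public

  -- The operations produce the pair (lower end, upper end) of the
  -- resulting interval; equality with [⊤,⊤] is componentwise.
  _⇒>_ : Interval → Interval → Carrier × Carrier
  X ⇒> Y = (hi X ⟶ lo Y) , (lo X ⟶ hi Y)

  _⇒_ : Interval → Interval → Carrier × Carrier
  X ⇒ Y = ((lo X ⟶ lo Y) ∧ (hi X ⟶ hi Y)) , (lo X ⟶ hi Y)

  IsTop : Carrier × Carrier → Set c
  IsTop P = (proj₁ P ≡ ⊤) × (proj₂ P ≡ ⊤)

  _≪_ : Interval → Interval → Set c
  X ≪ Y = IsTop (X ⇒> Y)

  _≾_ : Interval → Interval → Set c
  X ≾ Y = IsTop (X ⇒ Y)

module Submission where

-- If X ≪ Y then hi X ⪯ lo Y, so by transitivity through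
-- lo X ⪯ hi X and lo Y ⪯ hi Y both conjuncts of the lower end of X ⇒ Y
-- are ⊤, and their meet is ⊤ ∧ ⊤ = ⊤.  Part (b) is the same statement,
-- since "X ⇒> Y = [⊤,⊤]" is X ≪ Y and X ≾ Y is "X ⇒ Y = [⊤,⊤]".
--
-- Negative part.  ≾ is always reflexive, whereas ≪ is not: in the
-- two-element implication algebra the interval [0,1] satisfies
-- [0,1] ⇒> [0,1] = [0,1] ≠ [⊤,⊤].  This single interval refutes both
-- converse equivalences.

open import Defs
open import Level using (Level)
open import Data.Product using (_×_; _,_)
open import Relation.Nullary using (¬_)
open import Function.Bundles using (_⇔_; Equivalence)
open import Relation.Binary.PropositionalEquality using (_≡_; refl; subst; trans; cong₂)

module MeetBCIProperties {c : Level} (B : MeetBCI c) where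
  open MeetBCI B

  -- The only element above ⊤ is ⊤ itself: C2 with C3 gives u ⪯ (⊤ ⟶ u),
  -- which is u ⪯ ⊤ once ⊤ ⪯ u, and antisymmetry (C4) concludes.
  ⊤⪯⇒≡⊤ : ∀ {u} → ⊤ ⪯ u → u ≡ ⊤
  ⊤⪯⇒≡⊤ {u} ⊤⪯u = C4 u ⊤ u⪯⊤ ⊤⪯u
    where
      u⪯⊤⟶u : u ⪯ (⊤ ⟶ u)
      u⪯⊤⟶u = subst (λ t → u ⟶ (t ⟶ u) ≡ ⊤) (C3 u) (C2 u u)

      u⪯⊤ : u ⪯ ⊤
      u⪯⊤ = subst (λ t → u ⟶ t ≡ ⊤) ⊤⪯u u⪯⊤⟶u

  -- Transitivity of ⪯: C1 says x ⟶ y ⪯ (y ⟶ z) ⟶ (x ⟶ z); applying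
  -- ⊤⪯⇒≡⊤ twice discharges the two hypotheses.
  ⪯-trans : ∀ {x y z} → x ⪯ y → y ⪯ z → x ⪯ z
  ⪯-trans {x} {y} {z} x⪯y y⪯z = ⊤⪯⇒≡⊤ (subst (λ t → t ⟶ (x ⟶ z) ≡ ⊤) y⪯z step)
    where
      step : (y ⟶ z) ⟶ (x ⟶ z) ≡ ⊤
      step = ⊤⪯⇒≡⊤ (subst (λ t → t ⟶ ((y ⟶ z) ⟶ (x ⟶ z)) ≡ ⊤) x⪯y (C1 z x y))

  ∧-idem : ∀ x → x ∧ x ≡ x
  ∧-idem x = C4 (x ∧ x) x (∧-lowerˡ x x) (∧-greatest x x x (C3 x) (C3 x))

module IBCIProperties {c : Level} (B : MeetBCI c) where
  open MeetBCI B
  open IBCI B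
  open MeetBCIProperties B

  -- X ≪ Y implies X ≾ Y: hi X ⪯ lo Y forces lo X ⪯ lo Y and hi X ⪯ hi Y.
  ≪⇒≾ : ∀ X Y → X ≪ Y → X ≾ Y
  ≪⇒≾ X Y (hiX⪯loY , loX⪯hiY) = lower-end , loX⪯hiY
    where
      lower-end : (lo X ⟶ lo Y) ∧ (hi X ⟶ hi Y) ≡ ⊤
      lower-end = trans (cong₂ _∧_ (⪯-trans (lo⪯hi X) hiX⪯loY)
                                   (⪯-trans hiX⪯loY (lo⪯hi Y)))
                        (∧-idem ⊤)

  ≾-refl : ∀ X → X ≾ X
  ≾-refl X = trans (cong₂ _∧_ (C3 (lo X)) (C3 (hi X))) (∧-idem ⊤) , lo⪯hi X

module TwoElement {c : Level} where

  data Two : Set c where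
    true false : Two

  _⟶₂_ : Two → Two → Two
  true  ⟶₂ y = y
  false ⟶₂ y = true

  _∧₂_ : Two → Two → Two
  true  ∧₂ y = y
  false ∧₂ y = false

  𝟚 : MeetBCI c
  𝟚 = record
    { Carrier = Two ; _⟶_ = _⟶₂_ ; ⊤ = true
    ; C1 = λ { true true true → refl ; true true false → refl
             ; true false true → refl ; true false false → refl
             ; false true true → refl ; false true false → refl
             ; false false true → refl ; false false false → refl }
    ; C2 = λ { true true → refl ; true false → refl
             ; false true → refl ; false false → refl }
    ; C3 = λ { true → refl ; false → refl }
    ; C4 = λ { true true _ _ → refl ; false false _ _ → refl
             ; true false () _ ; false true _ () }
    ; _∧_ = _∧₂_
    ; ∧-lowerˡ = λ { true true → refl ; true false → refl
                   ; false true → refl ; false false → refl }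
    ; ∧-lowerʳ = λ { true true → refl ; true false → refl
                   ; false true → refl ; false false → refl }
    ; ∧-greatest = λ { true true true _ _ → refl ; true true false _ _ → refl
                     ; true false true _ () ; true false false _ _ → refl
                     ; false y true () _ ; false y false _ _ → refl }
    ; ⟶-∧-distrib = λ { true true true → refl ; true true false → refl
                      ; true false true → refl ; true false false → refl
                      ; false true true → refl ; false true false → refl
                      ; false false true → refl ; false false false → refl }
    }

  open IBCI 𝟚

  -- The interval [false , true] is not ≪-below itself, since its lower
  -- end true ⟶ false is false.
  full : Interval
  full = [ false , true ∣ refl ]

  ¬full≪full : ¬ (full ≪ full)
  ¬full≪full (() , _)

theorem5 : {c : Level} →
    (¬ ((B : MeetBCI c) → (X Y : IBCI.Interval B) →
        (IBCI._≪_ B X Y ⇔ IBCI.IsTop B (IBCI._⇒_ B X Y))))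
    × (¬ ((B : MeetBCI c) → (X Y : IBCI.Interval B) →
        (IBCI._≾_ B X Y ⇔ IBCI.IsTop B (IBCI._⇒>_ B X Y))))
    × ((B : MeetBCI c) → (X Y : IBCI.Interval B) →
        IBCI._≪_ B X Y → IBCI.IsTop B (IBCI._⇒_ B X Y))
    × ((B : MeetBCI c) → (X Y : IBCI.Interval B) →
        IBCI.IsTop B (IBCI._⇒>_ B X Y) → IBCI._≾_ B X Y)
theorem5 {c} =
    (λ H → ¬full≪full (Equivalence.from (H 𝟚 full full) full≾full))
  , (λ H → ¬full≪full (Equivalence.to (H 𝟚 full full) full≾full))
  , IBCIProperties.≪⇒≾
  , IBCIProperties.≪⇒≾   -- (b) unfolds to exactly the statement of (a)
  where
    open TwoElement {c}

    full≾full : IBCI._≾_ 𝟚 full full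
    full≾full = IBCIProperties.≾-refl 𝟚 full
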